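{- Let $(T_n)_{n\ge 0}$ be the Tribonacci sequence. If positive integers $n,\ell,m,d$ with $1\le d\le 9$ and $m\ge 2$ satisfy $$(T_{n}+1)(T_{n+1}+1)\cdots (T_{n+\ell-1}+1)=d\left(\frac{10^{m}-1}{9}\right),$$ then $\ell\leq 7$.
   Context: The Tribonacci sequence is defined by $T_0=0$, $T_1=T_2=1$ and $T_{n+3}=T_{n+2}+T_{n+1}+T_n$ for all $n\ge 0$. -}

module Defs where

open import Data.Nat using (ℕ; zero; suc; _+_; _*_; _∸_; _^_)
open import Data.Nat.DivMod using (_/_)

T : ℕ → ℕ
T zero = 0
T (suc zero) = 1
T (suc (suc zero)) = 1
T (suc (suc (suc n))) = T (suc (suc n)) + T (suc n) + T n

prodT : ℕ → ℕ → ℕ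
prodT n zero = 1
prodT n (suc ℓ) = (T n + 1) * prodT (suc n) ℓ

repunit : ℕ → ℕ
repunit m = (10 ^ m ∸ 1) / 9

{-# OPTIONS --safe #-}
module Submission where

open import Defs
open import Data.Nat using (ℕ; zero; suc; _+_; _*_; _∸_; _^_; _≤_; _≤?_; z≤n; s≤s; >-nonZero)
open import Data.Nat.Properties using (*-identityˡ; +-suc; *-comm; *-assoc; m+n∸n≡m; ≮⇒≥; ≤-trans)
open import Data.Nat.DivMod using (_/_; m*n/n≡m; _divMod_; DivMod; result)
open import Data.Nat.Divisibility
  using (_∣_; divides-refl; _∣?_; ∣-trans; 1∣_; ∣⇒≤; ∣m+n∣m⇒∣n; ∣m∣n⇒∣m+n; m∣m*n; ∣m⇒∣m*n; ∣n⇒∣m*n;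
         m*n∣⇒m∣; *-pres-∣; *-monoʳ-∣; *-cancelˡ-∣)
open import Data.Nat.Primality using (prime?; euclidsLemma)
open import Data.Nat.Solver using (module +-*-Solver)
open import Data.Fin using (zero; suc)
open import Data.Product using (_×_; _,_)
open import Data.Sum using (inj₁; inj₂)
open import Relation.Binary.PropositionalEquality
  using (_≡_; refl; sym; trans; cong; subst; module ≡-Reasoning)
open import Relation.Nullary using (¬_; contradiction)
open import Relation.Nullary.Decidable using (from-yes; from-no)

open +-*-Solver
open ≡-Reasoning

-- Since T (4 + n) = T n + 2 (T (1 + n) + T (2 + n)), the parity of T is 4-periodic: T n is
-- odd exactly when n ≡ 1, 2 (mod 4). So any four consecutive factors T i + 1 contain two
-- even ones, and a product of at least eight of them is divisible by 16. A repunit with at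
-- least one digit is odd, so the 2-adic valuation of d · repunit m is that of d ≤ 9, at most 3.

T[4+n]+1≡T[n]+1+2*[T[1+n]+T[2+n]] : ∀ n → T (4 + n) + 1 ≡ T n + 1 + 2 * (T (1 + n) + T (2 + n))
T[4+n]+1≡T[n]+1+2*[T[1+n]+T[2+n]] n =
  solve 3 (λ a b c → (c :+ b :+ a) :+ c :+ b :+ con 1 := a :+ con 1 :+ con 2 :* (b :+ c)) refl
    (T n) (T (1 + n)) (T (2 + n))

2∣T[n]+1⇒2∣T[4+n]+1 : ∀ n → 2 ∣ T n + 1 → 2 ∣ T (4 + n) + 1
2∣T[n]+1⇒2∣T[4+n]+1 n 2∣T[n]+1 =
  subst (2 ∣_) (sym (T[4+n]+1≡T[n]+1+2*[T[1+n]+T[2+n]] n)) (∣m∣n⇒∣m+n 2∣T[n]+1 (m∣m*n (T (1 + n) + T (2 + n))))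

2∣T[1+4q]+1×2∣T[2+4q]+1 : ∀ q → 2 ∣ T (1 + q * 4) + 1 × 2 ∣ T (2 + q * 4) + 1
2∣T[1+4q]+1×2∣T[2+4q]+1 zero    = divides-refl 1 , divides-refl 1
2∣T[1+4q]+1×2∣T[2+4q]+1 (suc q) =
  let p₁ , p₂ = 2∣T[1+4q]+1×2∣T[2+4q]+1 q
  in 2∣T[n]+1⇒2∣T[4+n]+1 (1 + q * 4) p₁ , 2∣T[n]+1⇒2∣T[4+n]+1 (2 + q * 4) p₂

4∣prodT[n,4] : ∀ n → 4 ∣ prodT n 4
4∣prodT[n,4] n = window (n divMod 4)
  where
  adjacent : ∀ {x y z} → 2 ∣ x → 2 ∣ y → 4 ∣ x * (y * z)
  adjacent 2∣x 2∣y = *-pres-∣ 2∣x (∣m⇒∣m*n _ 2∣y)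

  window : ∀ {n} → DivMod n 4 → 4 ∣ prodT n 4
  window (result q zero refl) =
    let p₁ , p₂ = 2∣T[1+4q]+1×2∣T[2+4q]+1 q in ∣n⇒∣m*n (T (q * 4) + 1) (adjacent p₁ p₂)
  window (result q (suc zero) refl) =
    let p₁ , p₂ = 2∣T[1+4q]+1×2∣T[2+4q]+1 q in adjacent p₁ p₂
  window (result q (suc (suc zero)) refl) =
    let _ , p₂ = 2∣T[1+4q]+1×2∣T[2+4q]+1 q
        p₁′ , _ = 2∣T[1+4q]+1×2∣T[2+4q]+1 (suc q)
    in *-pres-∣ p₂ (∣n⇒∣m*n (T (3 + q * 4) + 1) (∣n⇒∣m*n (T (4 + q * 4) + 1) (∣m⇒∣m*n 1 p₁′)))
  window (result q (suc (suc (suc zero))) refl) =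
    let p₁′ , p₂′ = 2∣T[1+4q]+1×2∣T[2+4q]+1 (suc q)
    in ∣n⇒∣m*n (T (3 + q * 4) + 1) (∣n⇒∣m*n (T (4 + q * 4) + 1) (adjacent p₁′ p₂′))

prodT-+ : ∀ n a b → prodT n (a + b) ≡ prodT n a * prodT (a + n) b
prodT-+ n zero    b = sym (*-identityˡ (prodT n b))
prodT-+ n (suc a) b = begin
  (T n + 1) * prodT (suc n) (a + b)                  ≡⟨ cong ((T n + 1) *_) (prodT-+ (suc n) a b) ⟩
  (T n + 1) * (prodT (suc n) a * prodT (a + suc n) b) ≡⟨ sym (*-assoc (T n + 1) (prodT (suc n) a) _) ⟩
  prodT n (suc a) * prodT (a + suc n) b              ≡⟨ cong (λ k → prodT n (suc a) * prodT k b) (+-suc a n) ⟩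
  prodT n (suc a) * prodT (suc a + n) b              ∎

prodT-mono-∣ : ∀ {n a b} → a ≤ b → prodT n a ∣ prodT n b
prodT-mono-∣ {n} {b = b} z≤n = 1∣ prodT n b
prodT-mono-∣ {n}         (s≤s a≤b) = *-monoʳ-∣ (T n + 1) (prodT-mono-∣ a≤b)

16∣prodT : ∀ {n ℓ} → 8 ≤ ℓ → 16 ∣ prodT n ℓ
16∣prodT {n} 8≤ℓ = ∣-trans 16∣prodT[n,8] (prodT-mono-∣ 8≤ℓ)
  where
  16∣prodT[n,8] : 16 ∣ prodT n 8
  16∣prodT[n,8] = subst (16 ∣_) (sym (prodT-+ n 4 4)) (*-pres-∣ (4∣prodT[n,4] n) (4∣prodT[n,4] (4 + n)))

ones : ℕ → ℕ
ones zero    = 0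
ones (suc m) = 10 * ones m + 1

10^m≡ones[m]*9+1 : ∀ m → 10 ^ m ≡ ones m * 9 + 1
10^m≡ones[m]*9+1 zero    = refl
10^m≡ones[m]*9+1 (suc m) = begin
  10 * 10 ^ m               ≡⟨ cong (10 *_) (10^m≡ones[m]*9+1 m) ⟩
  10 * (ones m * 9 + 1)     ≡⟨ solve 1 (λ r → con 10 :* (r :* con 9 :+ con 1) := (con 10 :* r :+ con 1) :* con 9 :+ con 1) refl (ones m) ⟩
  ones (suc m) * 9 + 1      ∎

repunit≡ones : ∀ m → repunit m ≡ ones m
repunit≡ones m = begin
  (10 ^ m ∸ 1) / 9          ≡⟨ cong (λ x → (x ∸ 1) / 9) (10^m≡ones[m]*9+1 m) ⟩
  (ones m * 9 + 1 ∸ 1) / 9  ≡⟨ cong (_/ 9) (m+n∸n≡m (ones m * 9) 1) ⟩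
  ones m * 9 / 9            ≡⟨ m*n/n≡m (ones m) 9 ⟩
  ones m                    ∎

2∤ones[1+m] : ∀ m → ¬ 2 ∣ ones (suc m)
2∤ones[1+m] m 2∣ones = from-no (2 ∣? 1) (∣m+n∣m⇒∣n 2∣ones (∣m⇒∣m*n (ones m) (divides-refl 5)))

2^k∣m*r⇒2^k∣m : ∀ k {m r} → ¬ 2 ∣ r → 2 ^ k ∣ m * r → 2 ^ k ∣ m
2^k∣m*r⇒2^k∣m zero    {m} _   _         = 1∣ m
2^k∣m*r⇒2^k∣m (suc k) {m} {r} 2∤r 2^[1+k]∣m*r
  with euclidsLemma m r (from-yes (prime? 2)) (m*n∣⇒m∣ 2 (2 ^ k) 2^[1+k]∣m*r)
... | inj₂ 2∣r            = contradiction 2∣r 2∤r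
... | inj₁ (divides-refl q) = subst (2 ^ suc k ∣_) (*-comm 2 q) (*-monoʳ-∣ 2 2^k∣q)
  where
  q*2*r≡2*[q*r] : q * 2 * r ≡ 2 * (q * r)
  q*2*r≡2*[q*r] = solve 2 (λ q r → q :* con 2 :* r := con 2 :* (q :* r)) refl q r

  2^k∣q : 2 ^ k ∣ q
  2^k∣q = 2^k∣m*r⇒2^k∣m k 2∤r (*-cancelˡ-∣ 2 (subst (2 ^ suc k ∣_) q*2*r≡2*[q*r] 2^[1+k]∣m*r))

lemma6 : (n ℓ m d : ℕ) → 1 ≤ n → 1 ≤ ℓ → 2 ≤ m → 1 ≤ d → d ≤ 9 →
         prodT n ℓ ≡ d * repunit m → ℓ ≤ 7
lemma6 n ℓ (suc m) d _ _ (s≤s _) 1≤d d≤9 prodT≡d*repunit = ≮⇒≥ λ 7<ℓ →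
  let 16∣d*ones = subst (16 ∣_) (trans prodT≡d*repunit (cong (d *_) (repunit≡ones (suc m)))) (16∣prodT 7<ℓ)
      16∣d      = 2^k∣m*r⇒2^k∣m 4 (2∤ones[1+m] m) 16∣d*ones
  in contradiction (≤-trans (∣⇒≤ {{>-nonZero 1≤d}} 16∣d) d≤9) (from-no (16 ≤? 9))
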